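{- For $m\geq0$ let $\mathrm{Match}_m(q)=\sum_{k=0}^{\lfloor m/2\rfloor}\binom{m}{2k}[1]_q[3]_q\cdots[2k-1]_q$ (the empty product being $1$). Then for every $n\geq0$ the matrix $(\mathrm{Match}_{i+j}(q))_{0\leq i,j\leq n}$ has special Smith normal form $\mathrm{diag}\big(1,q^{\binom12}[1]!_q,q^{\binom22}[2]!_q,\ldots,q^{\binom n2}[n]!_q\big)$ over $\mathbb{Z}[q]$.
   Context: $[k]_q=1+q+\cdots+q^{k-1}$, $[k]!_q=[1]_q\cdots[k]_q$. For an $m\times n$ matrix $A$ over a commutative ring $R$, a matrix $D$ is a special Smith normal form (SSNF) of $A$ over $R$ if there exist $P\in \mathrm{SL}(m,R)$, $Q\in\mathrm{SL}(n,R)$ with $PAQ=D$, $D$ is diagonal, and $d_{ii}$ is a multiple in $R$ of $d_{jj}$ whenever $i\geq j$. -}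

module Defs where

open import Data.Nat as ℕ using (ℕ; zero; suc; ⌊_/2⌋)
open import Data.Nat.Combinatorics using (_C_)
open import Data.Integer as ℤ using (ℤ; +_)
open import Data.List using (List; []; _∷_; replicate; map; _++_)
open import Data.Fin using (Fin; zero; suc; punchIn; toℕ; _≟_)
open import Relation.Nullary using (yes; no)
open import Data.Product using (Σ; _×_; ∃-syntax; _,_)
open import Relation.Binary.PropositionalEquality using (_≡_; _≢_)

-- The polynomial ring ℤ[q]: coefficient lists (constant term first),
-- with equality = equality of all coefficients (trailing zeros ignored).

Poly : Set
Poly = List ℤ

coeff : Poly → ℕ → ℤ
coeff []       _       = + 0
coeff (a ∷ p)  zero    = a
coeff (a ∷ p)  (suc k) = coeff p k

infix 4 _≈_
_≈_ : Poly → Poly → Set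
p ≈ r = ∀ k → coeff p k ≡ coeff r k

infixl 6 _+ₚ_
_+ₚ_ : Poly → Poly → Poly
[]      +ₚ r       = r
(a ∷ p) +ₚ []      = a ∷ p
(a ∷ p) +ₚ (b ∷ r) = (a ℤ.+ b) ∷ (p +ₚ r)

scale : ℤ → Poly → Poly
scale a p = map (a ℤ.*_) p

infixl 7 _*ₚ_
_*ₚ_ : Poly → Poly → Poly
[]      *ₚ r = []
(a ∷ p) *ₚ r = scale a r +ₚ (+ 0 ∷ (p *ₚ r))

-ₚ_ : Poly → Poly
-ₚ p = scale (ℤ.- (+ 1)) p

const : ℤ → Poly
const a = a ∷ []

0ₚ 1ₚ : Poly
0ₚ = []
1ₚ = const (+ 1)

qpow : ℕ → Poly
qpow k = replicate k (+ 0) ++ (+ 1 ∷ [])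

infix 4 _∣ₚ_
_∣ₚ_ : Poly → Poly → Set
d ∣ₚ p = ∃[ c ] (p ≈ c *ₚ d)

sumFin : ∀ {n} → (Fin n → Poly) → Poly
sumFin {zero}  f = 0ₚ
sumFin {suc n} f = f zero +ₚ sumFin (λ i → f (suc i))

sumUpTo : ℕ → (ℕ → Poly) → Poly
sumUpTo zero    f = f 0
sumUpTo (suc m) f = sumUpTo m f +ₚ f (suc m)

qint : ℕ → Poly
qint k = replicate k (+ 1)

qfact : ℕ → Poly
qfact zero    = 1ₚ
qfact (suc k) = qfact k *ₚ qint (suc k)

oddProd : ℕ → Poly
oddProd zero    = 1ₚ
oddProd (suc k) = oddProd k *ₚ qint (suc (2 ℕ.* k))

Match : ℕ → Poly
Match m = sumUpTo ⌊ m /2⌋ (λ k → const (+ (m C (2 ℕ.* k))) *ₚ oddProd k)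

Matrix : ℕ → ℕ → Set
Matrix m n = Fin m → Fin n → Poly

infixl 7 _·_
_·_ : ∀ {m n p} → Matrix m n → Matrix n p → Matrix m p
(A · B) i k = sumFin (λ j → A i j *ₚ B j k)

infix 4 _≈ₘ_
_≈ₘ_ : ∀ {m n} → Matrix m n → Matrix m n → Set
A ≈ₘ B = ∀ i j → A i j ≈ B i j

sign : ℕ → Poly
sign zero    = 1ₚ
sign (suc k) = -ₚ sign k

det : ∀ {n} → Matrix n n → Poly
det {zero}  A = 1ₚ
det {suc n} A =
  sumFin (λ i → sign (toℕ i) *ₚ A i zero *ₚ det (λ r c → A (punchIn i r) (suc c)))

IsSL : ∀ {n} → Matrix n n → Set
IsSL A = det A ≈ 1ₚ

IsDiagonal : ∀ {m n} → Matrix m n → Set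
IsDiagonal D = ∀ i j → toℕ i ≢ toℕ j → D i j ≈ 0ₚ

DiagDivChain : ∀ {m n} → Matrix m n → Set
DiagDivChain {m} {n} D = ∀ (i i' : Fin m) (j j' : Fin n) → toℕ i ≡ toℕ j → toℕ i' ≡ toℕ j' →
  toℕ i' ℕ.≤ toℕ i → D i' j' ∣ₚ D i j

IsSSNF : ∀ {m n} → Matrix m n → Matrix m n → Set
IsSSNF {m} {n} A D =
  (Σ (Matrix m m) λ P → Σ (Matrix n n) λ Q →
     IsSL P × IsSL Q × ((P · A) · Q ≈ₘ D))
  × IsDiagonal D × DiagDivChain D

MatchMatrix : (n : ℕ) → Matrix (suc n) (suc n)
MatchMatrix n i j = Match (toℕ i ℕ.+ toℕ j)

diagEntry : ℕ → Poly
diagEntry i = qpow (i C 2) *ₚ qfact i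

TargetDiag : (n : ℕ) → Matrix (suc n) (suc n)
TargetDiag n i j with i ≟ j
... | yes _ = diagEntry (toℕ i)
... | no  _ = 0ₚ

-- Put λ_k = q^k [k+1]_q, so that λ_0 ⋯ λ_{k-1} = q^(k choose 2) [k]!_q =: Λ_k, and let L(n, k) count
-- Motzkin paths of length n from height 0 to height k, a down step onto height k weighing λ_k.  One
-- step of such a path is the tridiagonal matrix J with entries 1, 1, λ_k, and diag(Λ) J is symmetric;
-- hence the entries of L diag(Λ) Lᵀ only depend on i + j, and equal L(i + j, 0).  Splitting a path
-- into its level steps and the remaining Dyck path, and counting Dyck paths in closed form with
-- q-binomial coefficients, gives L(m, 0) = Σ_a (m choose a) [1]_q [3]_q ⋯ [a-1]_q = Match_m (odd a
-- contribute 0).  So the Match matrix is L diag(Λ) Lᵀ with L lower unitriangular: L⁻¹ and its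
-- transpose lie in SL and bring it to diag(Λ), whose entries plainly form a divisibility chain.

module Submission where

open import Defs
open import Algebra.Bundles using (CommutativeRing)
open import Data.Empty using (⊥-elim)
open import Data.Fin using (Fin; zero; suc; toℕ; punchIn; _≟_)
import Data.Fin.Properties as FinP
open import Data.Integer as ℤ using (+_)
import Data.Integer.Properties as ℤP
open import Data.List using ([]; _∷_)
open import Data.Maybe using (nothing)
open import Data.Nat as ℕ using (ℕ; zero; suc; _<_; _≤_; z≤n; s≤s; ⌊_/2⌋)
open import Data.Nat.Combinatorics using (_C_; nCk+nC[k+1]≡[n+1]C[k+1]; nC1≡n; k>n⇒nCk≡0)
import Data.Nat.Properties as ℕP
open import Data.Product using (Σ-syntax; _×_; _,_)
open import Data.Sum using (_⊎_; inj₁; inj₂)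
open import Data.Unit using (⊤; tt)
open import Function using (_∘_)
open import Relation.Binary.Bundles using (Setoid)
open import Relation.Binary.PropositionalEquality using (_≡_; _≢_; refl; sym; trans; cong; cong₂; subst)
import Relation.Binary.Reasoning.Setoid as SetoidReasoning
open import Relation.Binary.Structures using (IsEquivalence)
open import Relation.Nullary using (Dec; yes; no)
open import Tactic.RingSolver using (solve-∀)
open import Tactic.RingSolver.Core.AlmostCommutativeRing using (AlmostCommutativeRing; fromCommutativeRing)

-- Wrapping _≈_ in a record lets Agda infer both polynomials from a proof of their equality.
infix 4 _≋_
record _≋_ (p r : Poly) : Set where
  constructor ≈⇒≋
  field ≋⇒≈ : p ≈ r
open _≋_ public

≋-refl : ∀ {p} → p ≋ p
≋-refl = ≈⇒≋ λ _ → refl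

≋-sym : ∀ {p r} → p ≋ r → r ≋ p
≋-sym (≈⇒≋ e) = ≈⇒≋ λ k → sym (e k)

≋-trans : ∀ {p r s} → p ≋ r → r ≋ s → p ≋ s
≋-trans (≈⇒≋ e) (≈⇒≋ f) = ≈⇒≋ λ k → trans (e k) (f k)

infixr 2 _⟨≋⟩_
_⟨≋⟩_ : ∀ {p r s} → p ≋ r → r ≋ s → p ≋ s
_⟨≋⟩_ = ≋-trans

≡⇒≋ : ∀ {p r} → p ≡ r → p ≋ r
≡⇒≋ refl = ≋-refl

≋-isEquivalence : IsEquivalence _≋_
≋-isEquivalence = record { refl = ≋-refl ; sym = ≋-sym ; trans = ≋-trans }

≋-setoid : Setoid _ _
≋-setoid = record { isEquivalence = ≋-isEquivalence }

module ≋-Reasoning = SetoidReasoning ≋-setoid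

∷-cong : ∀ {a b p r} → a ≡ b → p ≋ r → a ∷ p ≋ b ∷ r
∷-cong refl (≈⇒≋ e) = ≈⇒≋ λ { zero → refl ; (suc k) → e k }

∷-zero : ∀ {a p} → a ≡ + 0 → p ≋ [] → a ∷ p ≋ []
∷-zero refl (≈⇒≋ e) = ≈⇒≋ λ { zero → refl ; (suc k) → e k }

coeff-+ₚ : ∀ p r k → coeff (p +ₚ r) k ≡ coeff p k ℤ.+ coeff r k
coeff-+ₚ []      r       k       = sym (ℤP.+-identityˡ _)
coeff-+ₚ (a ∷ p) []      k       = sym (ℤP.+-identityʳ _)
coeff-+ₚ (a ∷ p) (b ∷ r) zero    = refl
coeff-+ₚ (a ∷ p) (b ∷ r) (suc k) = coeff-+ₚ p r k

coeff-scale : ∀ a p k → coeff (scale a p) k ≡ a ℤ.* coeff p k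
coeff-scale a []      k       = sym (ℤP.*-zeroʳ a)
coeff-scale a (b ∷ p) zero    = refl
coeff-scale a (b ∷ p) (suc k) = coeff-scale a p k

+ₚ-cong : ∀ {p p' r r'} → p ≋ p' → r ≋ r' → p +ₚ r ≋ p' +ₚ r'
+ₚ-cong {p} {p'} {r} {r'} (≈⇒≋ e) (≈⇒≋ f) = ≈⇒≋ λ k →
  trans (coeff-+ₚ p r k) (trans (cong₂ ℤ._+_ (e k) (f k)) (sym (coeff-+ₚ p' r' k)))

+ₚ-congˡ : ∀ {p p'} r → p ≋ p' → p +ₚ r ≋ p' +ₚ r
+ₚ-congˡ r e = +ₚ-cong e (≋-refl {r})

+ₚ-congʳ : ∀ p {r r'} → r ≋ r' → p +ₚ r ≋ p +ₚ r'
+ₚ-congʳ p = +ₚ-cong (≋-refl {p})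

+ₚ-assoc : ∀ p r s → (p +ₚ r) +ₚ s ≋ p +ₚ (r +ₚ s)
+ₚ-assoc []      r       s       = ≋-refl
+ₚ-assoc (a ∷ p) []      s       = ≋-refl
+ₚ-assoc (a ∷ p) (b ∷ r) []      = ≋-refl
+ₚ-assoc (a ∷ p) (b ∷ r) (c ∷ s) = ∷-cong (ℤP.+-assoc a b c) (+ₚ-assoc p r s)

+ₚ-comm : ∀ p r → p +ₚ r ≋ r +ₚ p
+ₚ-comm []      []      = ≋-refl
+ₚ-comm []      (b ∷ r) = ≋-refl
+ₚ-comm (a ∷ p) []      = ≋-refl
+ₚ-comm (a ∷ p) (b ∷ r) = ∷-cong (ℤP.+-comm a b) (+ₚ-comm p r)

+ₚ-identityʳ : ∀ p → p +ₚ [] ≋ p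
+ₚ-identityʳ []      = ≋-refl
+ₚ-identityʳ (a ∷ p) = ≋-refl

+ₚ-leftComm : ∀ a b c → a +ₚ (b +ₚ c) ≋ b +ₚ (a +ₚ c)
+ₚ-leftComm a b c = ≋-sym (+ₚ-assoc a b c) ⟨≋⟩ +ₚ-congˡ c (+ₚ-comm a b) ⟨≋⟩ +ₚ-assoc b a c

+ₚ-interchange : ∀ a b c d → (a +ₚ b) +ₚ (c +ₚ d) ≋ (a +ₚ c) +ₚ (b +ₚ d)
+ₚ-interchange a b c d =
  +ₚ-assoc a b (c +ₚ d) ⟨≋⟩ +ₚ-congʳ a (+ₚ-leftComm b c d) ⟨≋⟩ ≋-sym (+ₚ-assoc a c (b +ₚ d))

-ₚ‿inverseˡ : ∀ p → (-ₚ p) +ₚ p ≋ []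
-ₚ‿inverseˡ []      = ≋-refl
-ₚ‿inverseˡ (a ∷ p) = ∷-zero (trans (cong (ℤ._+ a) (ℤP.-1*i≡-i a)) (ℤP.+-inverseˡ a)) (-ₚ‿inverseˡ p)

scale-cong : ∀ a {p r} → p ≋ r → scale a p ≋ scale a r
scale-cong a {p} {r} (≈⇒≋ e) = ≈⇒≋ λ k →
  trans (coeff-scale a p k) (trans (cong (a ℤ.*_) (e k)) (sym (coeff-scale a r k)))

scale-distribˡ : ∀ a p r → scale a (p +ₚ r) ≋ scale a p +ₚ scale a r
scale-distribˡ a []      r       = ≋-refl
scale-distribˡ a (b ∷ p) []      = ≋-refl
scale-distribˡ a (b ∷ p) (c ∷ r) = ∷-cong (ℤP.*-distribˡ-+ a b c) (scale-distribˡ a p r)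

scale-distribʳ : ∀ a b p → scale (a ℤ.+ b) p ≋ scale a p +ₚ scale b p
scale-distribʳ a b []      = ≋-refl
scale-distribʳ a b (c ∷ p) = ∷-cong (ℤP.*-distribʳ-+ c a b) (scale-distribʳ a b p)

scale-assoc : ∀ a b p → scale a (scale b p) ≋ scale (a ℤ.* b) p
scale-assoc a b []      = ≋-refl
scale-assoc a b (c ∷ p) = ∷-cong (sym (ℤP.*-assoc a b c)) (scale-assoc a b p)

scale-zero : ∀ p → scale (+ 0) p ≋ []
scale-zero []      = ≋-refl
scale-zero (a ∷ p) = ∷-zero refl (scale-zero p)

scale-identity : ∀ p → scale (+ 1) p ≋ p
scale-identity []      = ≋-refl
scale-identity (a ∷ p) = ∷-cong (ℤP.*-identityˡ a) (scale-identity p)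

*ₚ-congʳ : ∀ p {r r'} → r ≋ r' → p *ₚ r ≋ p *ₚ r'
*ₚ-congʳ []      e = ≋-refl
*ₚ-congʳ (a ∷ p) e = +ₚ-cong (scale-cong a e) (∷-cong refl (*ₚ-congʳ p e))

*ₚ-zeroʳ : ∀ p → p *ₚ [] ≋ []
*ₚ-zeroʳ []      = ≋-refl
*ₚ-zeroʳ (a ∷ p) = ∷-zero refl (*ₚ-zeroʳ p)

*ₚ-∷ʳ : ∀ p b r → p *ₚ (b ∷ r) ≋ scale b p +ₚ (+ 0 ∷ p *ₚ r)
*ₚ-∷ʳ []      b r = ≋-sym (∷-zero refl ≋-refl)
*ₚ-∷ʳ (a ∷ p) b r =
  ∷-cong (cong (ℤ._+ + 0) (ℤP.*-comm a b))
         (+ₚ-congʳ (scale a r) (*ₚ-∷ʳ p b r) ⟨≋⟩ +ₚ-leftComm (scale a r) (scale b p) _)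

*ₚ-comm : ∀ p r → p *ₚ r ≋ r *ₚ p
*ₚ-comm []      r = ≋-sym (*ₚ-zeroʳ r)
*ₚ-comm (a ∷ p) r = +ₚ-congʳ (scale a r) (∷-cong refl (*ₚ-comm p r)) ⟨≋⟩ ≋-sym (*ₚ-∷ʳ r a p)

*ₚ-absorbʳ : ∀ p {r} → r ≋ [] → p *ₚ r ≋ []
*ₚ-absorbʳ p e = *ₚ-congʳ p e ⟨≋⟩ *ₚ-zeroʳ p

*ₚ-congˡ : ∀ {p p'} r → p ≋ p' → p *ₚ r ≋ p' *ₚ r
*ₚ-congˡ {p} {p'} r e = *ₚ-comm p r ⟨≋⟩ *ₚ-congʳ r e ⟨≋⟩ *ₚ-comm r p'

*ₚ-cong : ∀ {p p' r r'} → p ≋ p' → r ≋ r' → p *ₚ r ≋ p' *ₚ r'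
*ₚ-cong {p' = p'} {r = r} e f = *ₚ-congˡ r e ⟨≋⟩ *ₚ-congʳ p' f

*ₚ-distribʳ : ∀ r p p' → (p +ₚ p') *ₚ r ≋ p *ₚ r +ₚ p' *ₚ r
*ₚ-distribʳ r []      p'       = ≋-refl
*ₚ-distribʳ r (a ∷ p) []       = ≋-sym (+ₚ-identityʳ _)
*ₚ-distribʳ r (a ∷ p) (b ∷ p') =
  +ₚ-cong (scale-distribʳ a b r) (∷-cong refl (*ₚ-distribʳ r p p'))
  ⟨≋⟩ +ₚ-interchange (scale a r) (scale b r) (+ 0 ∷ p *ₚ r) (+ 0 ∷ p' *ₚ r)

*ₚ-distribˡ : ∀ p r r' → p *ₚ (r +ₚ r') ≋ p *ₚ r +ₚ p *ₚ r'
*ₚ-distribˡ p r r' =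
  *ₚ-comm p (r +ₚ r') ⟨≋⟩ *ₚ-distribʳ p r r' ⟨≋⟩ +ₚ-cong (*ₚ-comm r p) (*ₚ-comm r' p)

scale-*ₚ : ∀ a p r → scale a p *ₚ r ≋ scale a (p *ₚ r)
scale-*ₚ a []      r = ≋-refl
scale-*ₚ a (b ∷ p) r =
  +ₚ-cong (≋-sym (scale-assoc a b r)) (∷-cong (sym (ℤP.*-zeroʳ a)) (scale-*ₚ a p r))
  ⟨≋⟩ ≋-sym (scale-distribˡ a (scale b r) (+ 0 ∷ p *ₚ r))

*ₚ-assoc : ∀ p r s → (p *ₚ r) *ₚ s ≋ p *ₚ (r *ₚ s)
*ₚ-assoc []      r s = ≋-refl
*ₚ-assoc (a ∷ p) r s =
  *ₚ-distribʳ s (scale a r) (+ 0 ∷ p *ₚ r)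
  ⟨≋⟩ +ₚ-cong (scale-*ₚ a r s) (+ₚ-cong (scale-zero s) ≋-refl ⟨≋⟩ ∷-cong refl (*ₚ-assoc p r s))

*ₚ-identityˡ : ∀ p → 1ₚ *ₚ p ≋ p
*ₚ-identityˡ p = +ₚ-cong (scale-identity p) (∷-zero refl ≋-refl) ⟨≋⟩ +ₚ-identityʳ p

*ₚ-identityʳ : ∀ p → p *ₚ 1ₚ ≋ p
*ₚ-identityʳ p = *ₚ-comm p 1ₚ ⟨≋⟩ *ₚ-identityˡ p

ℤ[q] : CommutativeRing _ _
ℤ[q] = record
  { isCommutativeRing = record
    { isRing = record
      { +-isAbelianGroup = record
        { isGroup = record
          { isMonoid = record
            { isSemigroup = record
              { isMagma = record { isEquivalence = ≋-isEquivalence ; ∙-cong = +ₚ-cong }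
              ; assoc = +ₚ-assoc }
            ; identity = (λ _ → ≋-refl) , +ₚ-identityʳ }
          ; inverse = -ₚ‿inverseˡ , λ p → +ₚ-comm p (-ₚ p) ⟨≋⟩ -ₚ‿inverseˡ p
          ; ⁻¹-cong = scale-cong (ℤ.- (+ 1)) }
        ; comm = +ₚ-comm }
      ; *-cong = *ₚ-cong
      ; *-assoc = *ₚ-assoc
      ; *-identity = *ₚ-identityˡ , *ₚ-identityʳ
      ; distrib = *ₚ-distribˡ , *ₚ-distribʳ }
    ; *-comm = *ₚ-comm } }

ℤ[q]-solver : AlmostCommutativeRing _ _
ℤ[q]-solver = fromCommutativeRing ℤ[q] (λ _ → nothing)

sumBelow : ℕ → (ℕ → Poly) → Poly
sumBelow zero    f = []
sumBelow (suc K) f = sumBelow K f +ₚ f K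

sumBelow-cong : ∀ K {f g} → (∀ k → k < K → f k ≋ g k) → sumBelow K f ≋ sumBelow K g
sumBelow-cong zero    e = ≋-refl
sumBelow-cong (suc K) e = +ₚ-cong (sumBelow-cong K λ k k<K → e k (ℕP.m<n⇒m<1+n k<K)) (e K (ℕP.n<1+n K))

sumBelow-zero : ∀ K {f} → (∀ k → k < K → f k ≋ []) → sumBelow K f ≋ []
sumBelow-zero K e = sumBelow-cong K e ⟨≋⟩ sumBelow-const-[] K
  where
  sumBelow-const-[] : ∀ K → sumBelow K (λ _ → []) ≋ []
  sumBelow-const-[] zero    = ≋-refl
  sumBelow-const-[] (suc K) = +ₚ-identityʳ _ ⟨≋⟩ sumBelow-const-[] K

sumBelow-+ₚ : ∀ K f g → sumBelow K (λ k → f k +ₚ g k) ≋ sumBelow K f +ₚ sumBelow K g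
sumBelow-+ₚ zero    f g = ≋-refl
sumBelow-+ₚ (suc K) f g =
  +ₚ-cong (sumBelow-+ₚ K f g) ≋-refl ⟨≋⟩ +ₚ-interchange (sumBelow K f) (sumBelow K g) (f K) (g K)

sumBelow-*ₚˡ : ∀ K c f → c *ₚ sumBelow K f ≋ sumBelow K (λ k → c *ₚ f k)
sumBelow-*ₚˡ zero    c f = *ₚ-zeroʳ c
sumBelow-*ₚˡ (suc K) c f = *ₚ-distribˡ c (sumBelow K f) (f K) ⟨≋⟩ +ₚ-cong (sumBelow-*ₚˡ K c f) ≋-refl

sumBelow-suc : ∀ K f → sumBelow (suc K) f ≋ f 0 +ₚ sumBelow K (λ k → f (suc k))
sumBelow-suc zero    f = ≋-sym (+ₚ-identityʳ (f 0))
sumBelow-suc (suc K) f = +ₚ-cong (sumBelow-suc K f) ≋-refl ⟨≋⟩ +ₚ-assoc (f 0) _ _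

sumBelow-extend : ∀ K d f → (∀ k → K ≤ k → f k ≋ []) → sumBelow (d ℕ.+ K) f ≋ sumBelow K f
sumBelow-extend K zero    f e = ≋-refl
sumBelow-extend K (suc d) f e =
  +ₚ-cong (sumBelow-extend K d f e) (e (d ℕ.+ K) (ℕP.m≤n+m K d)) ⟨≋⟩ +ₚ-identityʳ _

sumFin-cong : ∀ {n} {f g : Fin n → Poly} → (∀ i → f i ≋ g i) → sumFin f ≋ sumFin g
sumFin-cong {zero}  e = ≋-refl
sumFin-cong {suc n} e = +ₚ-cong (e zero) (sumFin-cong λ i → e (suc i))

sumFin-zero : ∀ {n} {f : Fin n → Poly} → (∀ i → f i ≋ []) → sumFin f ≋ []
sumFin-zero {zero}  e = ≋-refl
sumFin-zero {suc n} e = +ₚ-cong (e zero) (sumFin-zero λ i → e (suc i))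

sumFin-toℕ : ∀ n f → sumFin {n} (λ i → f (toℕ i)) ≋ sumBelow n f
sumFin-toℕ zero    f = ≋-refl
sumFin-toℕ (suc n) f = +ₚ-cong ≋-refl (sumFin-toℕ n λ k → f (suc k)) ⟨≋⟩ ≋-sym (sumBelow-suc n f)

sumFin-+ₚ : ∀ {n} (f g : Fin n → Poly) → sumFin (λ i → f i +ₚ g i) ≋ sumFin f +ₚ sumFin g
sumFin-+ₚ {zero}  f g = ≋-refl
sumFin-+ₚ {suc n} f g =
  +ₚ-cong ≋-refl (sumFin-+ₚ (λ i → f (suc i)) (λ i → g (suc i)))
  ⟨≋⟩ +ₚ-interchange (f zero) (g zero) (sumFin λ i → f (suc i)) (sumFin λ i → g (suc i))

sumFin-*ₚˡ : ∀ {n} c (f : Fin n → Poly) → c *ₚ sumFin f ≋ sumFin (λ i → c *ₚ f i)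
sumFin-*ₚˡ {zero}  c f = *ₚ-zeroʳ c
sumFin-*ₚˡ {suc n} c f = *ₚ-distribˡ c (f zero) _ ⟨≋⟩ +ₚ-cong ≋-refl (sumFin-*ₚˡ c λ i → f (suc i))

sumFin-*ₚʳ : ∀ {n} c (f : Fin n → Poly) → sumFin f *ₚ c ≋ sumFin (λ i → f i *ₚ c)
sumFin-*ₚʳ c f = *ₚ-comm (sumFin f) c ⟨≋⟩ sumFin-*ₚˡ c f ⟨≋⟩ sumFin-cong λ i → *ₚ-comm c (f i)

sumFin-swap : ∀ {m n} (f : Fin m → Fin n → Poly) →
              sumFin (λ i → sumFin (λ j → f i j)) ≋ sumFin (λ j → sumFin (λ i → f i j))
sumFin-swap {zero} {n} f = ≋-sym (sumFin-zero {n} λ _ → ≋-refl)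
sumFin-swap {suc m} f =
  +ₚ-cong ≋-refl (sumFin-swap λ i j → f (suc i) j)
  ⟨≋⟩ ≋-sym (sumFin-+ₚ (λ j → f zero j) (λ j → sumFin λ i → f (suc i) j))

sumFin-δ : ∀ {n} (f : Fin n → Poly) k → (∀ j → j ≢ k → f j ≋ []) → sumFin f ≋ f k
sumFin-δ {suc n} f zero    e = +ₚ-cong ≋-refl (sumFin-zero λ i → e (suc i) λ ()) ⟨≋⟩ +ₚ-identityʳ _
sumFin-δ {suc n} f (suc k) e =
  +ₚ-cong (e zero λ ()) (sumFin-δ (λ i → f (suc i)) k λ j j≢k → e (suc j) (j≢k ∘ FinP.suc-injective))

infix 4 _≋ₘ_
_≋ₘ_ : ∀ {m n} → Matrix m n → Matrix m n → Set
A ≋ₘ B = ∀ i j → A i j ≋ B i j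

≋ₘ-refl : ∀ {m n} {A : Matrix m n} → A ≋ₘ A
≋ₘ-refl i j = ≋-refl

≋ₘ-sym : ∀ {m n} {A B : Matrix m n} → A ≋ₘ B → B ≋ₘ A
≋ₘ-sym e i j = ≋-sym (e i j)

infixr 2 _⟨≋ₘ⟩_
_⟨≋ₘ⟩_ : ∀ {m n} {A B C : Matrix m n} → A ≋ₘ B → B ≋ₘ C → A ≋ₘ C
(e ⟨≋ₘ⟩ f) i j = e i j ⟨≋⟩ f i j

·-cong : ∀ {m n p} {A A' : Matrix m n} {B B' : Matrix n p} → A ≋ₘ A' → B ≋ₘ B' → A · B ≋ₘ A' · B'
·-cong e f i k = sumFin-cong λ j → *ₚ-cong (e i j) (f j k)

·-assoc : ∀ {m n p r} (A : Matrix m n) (B : Matrix n p) (C : Matrix p r) → (A · B) · C ≋ₘ A · (B · C)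
·-assoc A B C i l =
  sumFin-cong (λ k → sumFin-*ₚʳ (C k l) λ j → A i j *ₚ B j k)
  ⟨≋⟩ sumFin-swap (λ k j → (A i j *ₚ B j k) *ₚ C k l)
  ⟨≋⟩ sumFin-cong λ j → sumFin-cong (λ k → *ₚ-assoc (A i j) (B j k) (C k l))
                         ⟨≋⟩ ≋-sym (sumFin-*ₚˡ (A i j) λ k → B j k *ₚ C k l)

infix 10 _ᵀ
_ᵀ : ∀ {m n} → Matrix m n → Matrix n m
(A ᵀ) i j = A j i

·-ᵀ : ∀ {m n p} (A : Matrix m n) (B : Matrix n p) → (A · B) ᵀ ≋ₘ B ᵀ · A ᵀ
·-ᵀ A B i k = sumFin-cong λ j → *ₚ-comm (A k j) (B j i)

diag : ∀ {n} → (Fin n → Poly) → Matrix n n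
diag d i j with i ≟ j
... | yes _ = d i
... | no  _ = []

diag-≡ : ∀ {n} (d : Fin n → Poly) i → diag d i i ≋ d i
diag-≡ d i with i ≟ i
... | yes _  = ≋-refl
... | no i≢i = ⊥-elim (i≢i refl)

diag-≢ : ∀ {n} (d : Fin n → Poly) {i j} → i ≢ j → diag d i j ≋ []
diag-≢ d {i} {j} i≢j with i ≟ j
... | yes i≡j = ⊥-elim (i≢j i≡j)
... | no  _   = ≋-refl

·-diag : ∀ {m n} (A : Matrix m n) d → A · diag d ≋ₘ (λ i k → A i k *ₚ d k)
·-diag A d i k =
  sumFin-δ _ k (λ j j≢k → *ₚ-congʳ (A i j) (diag-≢ d j≢k) ⟨≋⟩ *ₚ-zeroʳ (A i j))
  ⟨≋⟩ *ₚ-congʳ (A i k) (diag-≡ d k)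

diag-· : ∀ {m n} d (A : Matrix m n) → diag d · A ≋ₘ (λ i k → d i *ₚ A i k)
diag-· d A i k =
  sumFin-δ _ i (λ j j≢i → *ₚ-congˡ (A j k) (diag-≢ d (j≢i ∘ sym)))
  ⟨≋⟩ *ₚ-congˡ (A i k) (diag-≡ d i)

1ₘ : ∀ {n} → Matrix n n
1ₘ = diag λ _ → 1ₚ

1ₘ-· : ∀ {m n} (A : Matrix m n) → 1ₘ · A ≋ₘ A
1ₘ-· A = diag-· _ A ⟨≋ₘ⟩ λ i k → *ₚ-identityˡ (A i k)

·-1ₘ : ∀ {m n} (A : Matrix m n) → A · 1ₘ ≋ₘ A
·-1ₘ A = ·-diag A _ ⟨≋ₘ⟩ λ i k → *ₚ-identityʳ (A i k)

diag-ᵀ : ∀ {n} (d : Fin n → Poly) → diag d ᵀ ≋ₘ diag d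
diag-ᵀ d i j = symmetric (i ≟ j)
  where
  symmetric : Dec (i ≡ j) → diag d j i ≋ diag d i j
  symmetric (yes refl) = ≋-refl
  symmetric (no i≢j)   = diag-≢ d (i≢j ∘ sym) ⟨≋⟩ ≋-sym (diag-≢ d i≢j)

≋ₘ-setoid : ℕ → ℕ → Setoid _ _
≋ₘ-setoid m n = record
  { Carrier = Matrix m n
  ; _≈_ = _≋ₘ_
  ; isEquivalence = record { refl = ≋ₘ-refl ; sym = ≋ₘ-sym ; trans = _⟨≋ₘ⟩_ } }

module ≋ₘ-Reasoning {m n : ℕ} = SetoidReasoning (≋ₘ-setoid m n)

-- Unitriangular matrices and their determinants

lowerRight : ∀ {m n} → Matrix (suc m) (suc n) → Matrix m n
lowerRight A r c = A (suc r) (suc c)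

lowerRight-diag : ∀ {n} (d : Fin (suc n) → Poly) → lowerRight (diag d) ≋ₘ diag (d ∘ suc)
lowerRight-diag d r c = compare (r ≟ c)
  where
  compare : Dec (r ≡ c) → diag d (suc r) (suc c) ≋ diag (d ∘ suc) r c
  compare (yes refl) = diag-≡ d (suc r) ⟨≋⟩ ≋-sym (diag-≡ (d ∘ suc) r)
  compare (no r≢c)   = diag-≢ d (r≢c ∘ FinP.suc-injective) ⟨≋⟩ ≋-sym (diag-≢ (d ∘ suc) r≢c)

IsLowerUnitriangular : ∀ {n} → Matrix n n → Set
IsLowerUnitriangular {zero}  A = ⊤
IsLowerUnitriangular {suc n} A =
  A zero zero ≋ 1ₚ × (∀ c → A zero (suc c) ≋ []) × IsLowerUnitriangular (lowerRight A)

IsUpperUnitriangular : ∀ {n} → Matrix n n → Set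
IsUpperUnitriangular A = IsLowerUnitriangular (A ᵀ)

IsLowerUnitriangular-resp : ∀ {n} {A B : Matrix n n} →
                            A ≋ₘ B → IsLowerUnitriangular A → IsLowerUnitriangular B
IsLowerUnitriangular-resp {zero}  e _ = tt
IsLowerUnitriangular-resp {suc n} e (a , b , c) =
  (≋-sym (e zero zero) ⟨≋⟩ a) , (λ k → ≋-sym (e zero (suc k)) ⟨≋⟩ b k) ,
  IsLowerUnitriangular-resp (λ r k → e (suc r) (suc k)) c

minor : ∀ {n} → Matrix (suc n) (suc n) → Fin (suc n) → Matrix n n
minor A i r c = A (punchIn i r) (suc c)

expansionTerm : ∀ {n} → Matrix (suc n) (suc n) → Fin (suc n) → Poly
expansionTerm A i = sign (toℕ i) *ₚ A i zero *ₚ det (minor A i)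

mutual
  det-row₀-zero : ∀ {n} (A : Matrix (suc n) (suc n)) → (∀ c → A zero c ≋ []) → det A ≋ []
  det-row₀-zero A e = sumFin-zero {f = expansionTerm A} λ
    { zero    → *ₚ-congˡ (det (minor A zero)) (*ₚ-congʳ 1ₚ (e zero) ⟨≋⟩ *ₚ-zeroʳ 1ₚ)
    ; (suc i) → *ₚ-absorbʳ (sign (toℕ (suc i)) *ₚ A (suc i) zero) (det-minor-row₀-zero A (e ∘ suc) i) }

  -- row 0 of A survives (shifted) in every minor but the first
  det-minor-row₀-zero : ∀ {n} (A : Matrix (suc n) (suc n)) → (∀ c → A zero (suc c) ≋ []) →
                        ∀ i → det (minor A (suc i)) ≋ []
  det-minor-row₀-zero {suc n} A e i = det-row₀-zero (minor A (suc i)) e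

det-unit-pivot : ∀ {n} (A : Matrix (suc n) (suc n)) → A zero zero ≋ 1ₚ → det (lowerRight A) ≋ 1ₚ →
                 expansionTerm A zero ≋ 1ₚ
det-unit-pivot A a d = *ₚ-cong (*ₚ-identityˡ _ ⟨≋⟩ a) d ⟨≋⟩ *ₚ-identityˡ 1ₚ

det-lowerUnitriangular : ∀ {n} (A : Matrix n n) → IsLowerUnitriangular A → det A ≋ 1ₚ
det-lowerUnitriangular {zero}  A _           = ≋-refl
det-lowerUnitriangular {suc n} A (a , b , c) =
  sumFin-δ (expansionTerm A) zero
    (λ { zero 0≢0 → ⊥-elim (0≢0 refl)
       ; (suc i) _ → *ₚ-absorbʳ (sign (toℕ (suc i)) *ₚ A (suc i) zero) (det-minor-row₀-zero A b i) })
  ⟨≋⟩ det-unit-pivot A a (det-lowerUnitriangular (lowerRight A) c)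

det-upperUnitriangular : ∀ {n} (A : Matrix n n) → IsUpperUnitriangular A → det A ≋ 1ₚ
det-upperUnitriangular {zero}  A _           = ≋-refl
det-upperUnitriangular {suc n} A (a , b , c) =
  sumFin-δ (expansionTerm A) zero
    (λ { zero 0≢0 → ⊥-elim (0≢0 refl)
       ; (suc i) _ → *ₚ-congˡ (det (minor A (suc i))) (*ₚ-absorbʳ (sign (toℕ (suc i))) (b i)) })
  ⟨≋⟩ det-unit-pivot A a (det-upperUnitriangular (lowerRight A) c)

-- forward substitution: the first column is chosen to cancel that of L
lowerInverse : ∀ {n} → Matrix n n → Matrix n n
lowerInverse {suc n} L zero    zero    = 1ₚ
lowerInverse {suc n} L zero    (suc c) = []
lowerInverse {suc n} L (suc r) zero    =
  -ₚ sumFin (λ j → lowerInverse (lowerRight L) r j *ₚ L (suc j) zero)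
lowerInverse {suc n} L (suc r) (suc c) = lowerInverse (lowerRight L) r c

lowerInverse-lowerUnitriangular : ∀ {n} (L : Matrix n n) → IsLowerUnitriangular (lowerInverse L)
lowerInverse-lowerUnitriangular {zero}  L = tt
lowerInverse-lowerUnitriangular {suc n} L =
  ≋-refl , (λ _ → ≋-refl) , lowerInverse-lowerUnitriangular (lowerRight L)

lowerInverse-· : ∀ {n} (L : Matrix n n) → IsLowerUnitriangular L → lowerInverse L · L ≋ₘ 1ₘ
lowerInverse-· {suc n} L (a , b , c) zero zero =
  +ₚ-cong (*ₚ-identityˡ (L zero zero) ⟨≋⟩ a) (sumFin-zero {n} λ _ → ≋-refl)
  ⟨≋⟩ ≋-sym (diag-≡ {suc n} (λ _ → 1ₚ) zero)
lowerInverse-· {suc n} L (a , b , c) zero (suc k) =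
  +ₚ-cong (*ₚ-identityˡ (L zero (suc k)) ⟨≋⟩ b k) (sumFin-zero {n} λ _ → ≋-refl)
  ⟨≋⟩ ≋-sym (diag-≢ (λ _ → 1ₚ) {zero} {suc k} λ ())
lowerInverse-· {suc n} L (a , b , c) (suc r) zero =
  +ₚ-cong (*ₚ-congʳ (-ₚ s) a ⟨≋⟩ *ₚ-identityʳ (-ₚ s)) ≋-refl ⟨≋⟩ -ₚ‿inverseˡ s
  ⟨≋⟩ ≋-sym (diag-≢ (λ _ → 1ₚ) {suc r} {zero} λ ())
  where
  s : Poly
  s = sumFin λ j → lowerInverse (lowerRight L) r j *ₚ L (suc j) zero
lowerInverse-· {suc n} L (a , b , c) (suc r) (suc k) =
  +ₚ-cong (*ₚ-absorbʳ (lowerInverse L (suc r) zero) (b k)) ≋-refl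
  ⟨≋⟩ lowerInverse-· (lowerRight L) c r k ⟨≋⟩ ≋-sym (lowerRight-diag (λ _ → 1ₚ) r k)

unitriangular-congruence : ∀ {n} (A L : Matrix n n) (d : Fin n → Poly) → IsLowerUnitriangular L →
                           A ≋ₘ (L · diag d) · L ᵀ → (lowerInverse L · A) · lowerInverse L ᵀ ≋ₘ diag d
unitriangular-congruence {n} A L d lower A≋LDLᵀ = begin
  (P · A) · P ᵀ                   ≈⟨ ·-cong (·-cong (≋ₘ-refl {A = P}) A≋LDLᵀ) (≋ₘ-refl {A = P ᵀ}) ⟩
  (P · ((L · D) · L ᵀ)) · P ᵀ     ≈⟨ ·-cong (≋ₘ-sym (·-assoc P (L · D) (L ᵀ))) (≋ₘ-refl {A = P ᵀ}) ⟩
  ((P · (L · D)) · L ᵀ) · P ᵀ     ≈⟨ ·-assoc (P · (L · D)) (L ᵀ) (P ᵀ) ⟩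
  (P · (L · D)) · (L ᵀ · P ᵀ)     ≈⟨ ·-cong (≋ₘ-sym (·-assoc P L D)) (≋ₘ-sym (·-ᵀ P L)) ⟩
  ((P · L) · D) · (P · L) ᵀ       ≈⟨ ·-cong (·-cong PL≋1ₘ (≋ₘ-refl {A = D})) (λ i j → PL≋1ₘ j i) ⟩
  (1ₘ · D) · 1ₘ ᵀ                 ≈⟨ ·-cong (1ₘ-· D) (diag-ᵀ _) ⟩
  D · 1ₘ                          ≈⟨ ·-1ₘ D ⟩
  D                               ∎
  where
  open ≋ₘ-Reasoning
  P D : Matrix n n
  P = lowerInverse L
  D = diag d
  PL≋1ₘ : P · L ≋ₘ 1ₘ
  PL≋1ₘ = lowerInverse-· L lower

-- Weighted lattice paths

previous : (ℕ → Poly) → ℕ → Poly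
previous f zero    = []
previous f (suc k) = f k

sumBelow-previous : ∀ K (f g : ℕ → Poly) →
  sumBelow (suc K) (λ k → previous f k *ₚ g k) ≋ sumBelow K (λ k → f k *ₚ g (suc k))
sumBelow-previous K f g = sumBelow-suc K (λ k → previous f k *ₚ g k)

previous-cong : ∀ {a b} → (∀ k → a k ≋ b k) → ∀ k → previous a k ≋ previous b k
previous-cong e zero    = ≋-refl
previous-cong e (suc k) = e k

binomial : ℕ → ℕ → Poly
binomial n a = const (+ (n C a))

module WeightedPaths (w : ℕ → Poly) where

  -- One step of a path ending at height k: up from k - 1, level at k, or down from k + 1, the
  -- last one weighted by w k.
  step : (ℕ → Poly) → ℕ → Poly
  step a k = (previous a k +ₚ a k) +ₚ w k *ₚ a (suc k)

  step-cong : ∀ {a b} → (∀ k → a k ≋ b k) → ∀ k → step a k ≋ step b k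
  step-cong e k = +ₚ-cong (+ₚ-cong (previous-cong e k) (e k)) (*ₚ-congʳ (w k) (e (suc k)))

  -- motzkin n k is the weighted count of n-step Motzkin paths from height 0 to height k
  motzkin : ℕ → ℕ → Poly
  motzkin zero    zero    = 1ₚ
  motzkin zero    (suc k) = []
  motzkin (suc n) k       = step (motzkin n) k

  -- the same without level steps
  dyck : ℕ → ℕ → Poly
  dyck zero    zero    = 1ₚ
  dyck zero    (suc k) = []
  dyck (suc n) k       = previous (dyck n) k +ₚ w k *ₚ dyck n (suc k)

  weight : ℕ → Poly
  weight zero    = 1ₚ
  weight (suc k) = w k *ₚ weight k

  weight-∣ : ∀ d a → Σ[ c ∈ Poly ] weight (d ℕ.+ a) ≋ c *ₚ weight a
  weight-∣ zero    a = 1ₚ , ≋-sym (*ₚ-identityˡ (weight a))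
  weight-∣ (suc d) a =
    let c , e = weight-∣ d a in
    w (d ℕ.+ a) *ₚ c , (*ₚ-congʳ (w (d ℕ.+ a)) e ⟨≋⟩ ≋-sym (*ₚ-assoc (w (d ℕ.+ a)) c (weight a)))

  motzkin-upper : ∀ n k → n < k → motzkin n k ≋ []
  motzkin-upper zero    (suc k) _         = ≋-refl
  motzkin-upper (suc n) (suc k) (s≤s n<k) =
    +ₚ-cong (+ₚ-cong (motzkin-upper n k n<k) (motzkin-upper n (suc k) (ℕP.m<n⇒m<1+n n<k)))
            (*ₚ-absorbʳ (w (suc k)) (motzkin-upper n (2 ℕ.+ k) (ℕP.m<n⇒m<1+n (ℕP.m<n⇒m<1+n n<k))))

  dyck-cong : ∀ {m n} k → m ≡ n → dyck m k ≋ dyck n k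
  dyck-cong k refl = ≋-refl

  dyck-upper : ∀ n k → n < k → dyck n k ≋ []
  dyck-upper zero    (suc k) _         = ≋-refl
  dyck-upper (suc n) (suc k) (s≤s n<k) =
    +ₚ-cong (dyck-upper n k n<k)
            (*ₚ-absorbʳ (w (suc k)) (dyck-upper n (2 ℕ.+ k) (ℕP.m<n⇒m<1+n (ℕP.m<n⇒m<1+n n<k))))

  motzkin-diag : ∀ n → motzkin n n ≋ 1ₚ
  motzkin-diag zero    = ≋-refl
  motzkin-diag (suc n) =
    +ₚ-cong (+ₚ-cong (motzkin-diag n) (motzkin-upper n (suc n) (ℕP.n<1+n n)))
            (*ₚ-absorbʳ (w (suc n)) (motzkin-upper n (2 ℕ.+ n) (ℕP.m<n⇒m<1+n (ℕP.n<1+n n))))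
    ⟨≋⟩ +ₚ-identityʳ _ ⟨≋⟩ +ₚ-identityʳ _

  motzkin-lowerUnitriangular : ∀ n s →
                               IsLowerUnitriangular {n} (λ i j → motzkin (s ℕ.+ toℕ i) (s ℕ.+ toℕ j))
  motzkin-lowerUnitriangular zero    s = tt
  motzkin-lowerUnitriangular (suc n) s =
    motzkin-diag (s ℕ.+ 0) ,
    (λ c → motzkin-upper (s ℕ.+ 0) (s ℕ.+ suc (toℕ c)) (ℕP.+-monoʳ-< s (s≤s z≤n))) ,
    IsLowerUnitriangular-resp
      (λ r c → ≡⇒≋ (cong₂ motzkin (sym (ℕP.+-suc s (toℕ r))) (sym (ℕP.+-suc s (toℕ c)))))
      (motzkin-lowerUnitriangular n (suc s))

  pairing : ℕ → (ℕ → Poly) → (ℕ → Poly) → Poly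
  pairing K a b = sumBelow K λ k → a k *ₚ weight k *ₚ b k

  pairing-comm : ∀ K a b → pairing K a b ≋ pairing K b a
  pairing-comm K a b = sumBelow-cong K λ k _ → mirror (a k) (weight k) (b k)
    where
    mirror : ∀ x m z → x *ₚ m *ₚ z ≋ z *ₚ m *ₚ x
    mirror = solve-∀ ℤ[q]-solver

  upPart downPart : ℕ → (ℕ → Poly) → (ℕ → Poly) → Poly
  upPart   K a b = sumBelow K λ k → previous a k *ₚ (weight k *ₚ b k)
  downPart K a b = sumBelow K λ k → a k *ₚ weight k *ₚ (w k *ₚ b (suc k))

  pairing-stepˡ : ∀ K a b → pairing K (step a) b ≋ (upPart K a b +ₚ pairing K a b) +ₚ downPart K b a
  pairing-stepˡ K a b =
    sumBelow-cong K (λ k _ → expand (previous a k) (a k) (w k) (a (suc k)) (weight k) (b k))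
    ⟨≋⟩ sumBelow-+ₚ K _ _ ⟨≋⟩ +ₚ-cong (sumBelow-+ₚ K _ _) ≋-refl
    where
    expand : ∀ p x v y m z →
             ((p +ₚ x) +ₚ v *ₚ y) *ₚ m *ₚ z ≋ (p *ₚ (m *ₚ z) +ₚ x *ₚ m *ₚ z) +ₚ z *ₚ m *ₚ (v *ₚ y)
    expand = solve-∀ ℤ[q]-solver

  -- the up step into height k + 1 pairs with the down step out of it, as weight (k + 1) = w k · weight k
  upPart≋downPart : ∀ K a b → b K ≋ [] → upPart K a b ≋ downPart K a b
  upPart≋downPart zero    a b _     = ≋-refl
  upPart≋downPart (suc K) a b bK≋[] =
    sumBelow-previous K a (λ k → weight k *ₚ b k)
    ⟨≋⟩ sumBelow-cong K (λ k _ → regroup (a k) (w k) (weight k) (b (suc k)))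
    ⟨≋⟩ ≋-sym (+ₚ-cong ≋-refl (*ₚ-absorbʳ (a K *ₚ weight K) (*ₚ-absorbʳ (w K) bK≋[])) ⟨≋⟩ +ₚ-identityʳ _)
    where
    regroup : ∀ x v m y → x *ₚ (v *ₚ m *ₚ y) ≋ x *ₚ m *ₚ (v *ₚ y)
    regroup = solve-∀ ℤ[q]-solver

  step-selfAdjoint : ∀ K a b → a K ≋ [] → b K ≋ [] → pairing K (step a) b ≋ pairing K a (step b)
  step-selfAdjoint K a b aK≋[] bK≋[] = begin
    pairing K (step a) b
      ≈⟨ pairing-stepˡ K a b ⟩
    (upPart K a b +ₚ pairing K a b) +ₚ downPart K b a
      ≈⟨ +ₚ-cong (+ₚ-cong (upPart≋downPart K a b bK≋[]) (pairing-comm K a b))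
                 (≋-sym (upPart≋downPart K b a aK≋[])) ⟩
    (downPart K a b +ₚ pairing K b a) +ₚ upPart K b a
      ≈⟨ swap (downPart K a b) (pairing K b a) (upPart K b a) ⟩
    (upPart K b a +ₚ pairing K b a) +ₚ downPart K a b
      ≈⟨ pairing-stepˡ K b a ⟨
    pairing K (step b) a
      ≈⟨ pairing-comm K (step b) a ⟩
    pairing K a (step b) ∎
    where
    open ≋-Reasoning
    swap : ∀ x g y → (x +ₚ g) +ₚ y ≋ (y +ₚ g) +ₚ x
    swap = solve-∀ ℤ[q]-solver

  pairing-motzkin₀ : ∀ K b → pairing (suc K) (motzkin 0) b ≋ b 0
  pairing-motzkin₀ K b =
    sumBelow-suc K _ ⟨≋⟩ +ₚ-cong (*ₚ-identityˡ (b 0)) (sumBelow-zero K λ _ _ → ≋-refl) ⟨≋⟩ +ₚ-identityʳ (b 0)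

  -- repeatedly moving a step from the left path to the right one
  pairing-motzkin : ∀ K i j → i ℕ.+ j < K → pairing K (motzkin i) (motzkin j) ≋ motzkin (i ℕ.+ j) 0
  pairing-motzkin (suc K) zero    j _  = pairing-motzkin₀ K (motzkin j)
  pairing-motzkin K       (suc i) j lt =
    step-selfAdjoint K (motzkin i) (motzkin j)
      (motzkin-upper i K (ℕP.<-trans (ℕP.m≤m+n (suc i) j) lt))
      (motzkin-upper j K (ℕP.≤-<-trans (ℕP.m≤n+m j (suc i)) lt))
    ⟨≋⟩ pairing-motzkin K i (suc j) (subst (_< K) (sym (ℕP.+-suc i j)) lt)
    ⟨≋⟩ ≡⇒≋ (cong (λ m → motzkin m 0) (ℕP.+-suc i j))

  motzkin-gram : ∀ n i j → i ≤ n → j ≤ n → pairing (suc n) (motzkin i) (motzkin j) ≋ motzkin (i ℕ.+ j) 0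
  motzkin-gram n i j i≤n j≤n =
    ≋-sym (sumBelow-extend (suc n) n _ beyond) ⟨≋⟩ pairing-motzkin (n ℕ.+ suc n) i j bound
    where
    beyond : ∀ k → suc n ≤ k → motzkin i k *ₚ weight k *ₚ motzkin j k ≋ []
    beyond k n<k =
      *ₚ-congˡ (motzkin j k) (*ₚ-congˡ (weight k) (motzkin-upper i k (ℕP.<-≤-trans (s≤s i≤n) n<k)))
    bound : i ℕ.+ j < n ℕ.+ suc n
    bound = ℕP.≤-<-trans (ℕP.+-mono-≤ i≤n j≤n) (ℕP.+-monoʳ-< n (ℕP.n<1+n n))

  -- a Motzkin path is a choice of the a steps that are not level, together with a Dyck path of length a
  dyckSum : ℕ → ℕ → Poly
  dyckSum n k = sumBelow (suc n) λ a → binomial n a *ₚ dyck a k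

  dyckSum-dyckStep : ∀ n k → sumBelow (suc n) (λ a → binomial n a *ₚ dyck (suc a) k)
                            ≋ previous (dyckSum n) k +ₚ w k *ₚ dyckSum n (suc k)
  dyckSum-dyckStep n k =
    sumBelow-cong (suc n) (λ a _ → *ₚ-distribˡ (binomial n a) (previous (dyck a) k) _)
    ⟨≋⟩ sumBelow-+ₚ (suc n) _ _
    ⟨≋⟩ +ₚ-cong (previous-sum k)
                (sumBelow-cong (suc n) (λ a _ → leftComm (binomial n a) (w k) (dyck a (suc k)))
                 ⟨≋⟩ ≋-sym (sumBelow-*ₚˡ (suc n) (w k) λ a → binomial n a *ₚ dyck a (suc k)))
    where
    leftComm : ∀ c v x → c *ₚ (v *ₚ x) ≋ v *ₚ (c *ₚ x)
    leftComm = solve-∀ ℤ[q]-solver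
    previous-sum : ∀ k →
                   sumBelow (suc n) (λ a → binomial n a *ₚ previous (dyck a) k) ≋ previous (dyckSum n) k
    previous-sum zero    = sumBelow-zero (suc n) λ a _ → *ₚ-zeroʳ (binomial n a)
    previous-sum (suc k) = ≋-refl

  dyckSum-step : ∀ n k → dyckSum (suc n) k ≋ step (dyckSum n) k
  dyckSum-step n k = begin
    dyckSum (suc n) k
      ≈⟨ sumBelow-suc (suc n) (λ a → binomial (suc n) a *ₚ dyck a k) ⟩
    term 0 +ₚ sumBelow (suc n) (λ a → binomial (suc n) (suc a) *ₚ dyck (suc a) k)
      ≈⟨ +ₚ-congʳ (term 0) (sumBelow-cong (suc n) (λ a _ → split a) ⟨≋⟩ sumBelow-+ₚ (suc n) lower upper) ⟩
    term 0 +ₚ (sumBelow (suc n) lower +ₚ sumBelow (suc n) upper)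
      ≈⟨ +ₚ-leftComm (term 0) (sumBelow (suc n) lower) (sumBelow (suc n) upper) ⟩
    sumBelow (suc n) lower +ₚ (term 0 +ₚ sumBelow (suc n) upper)
      ≈⟨ +ₚ-cong (dyckSum-dyckStep n k)
                 (≋-sym (sumBelow-suc (suc n) term)
                  ⟨≋⟩ +ₚ-congʳ (dyckSum n k) top-vanishes ⟨≋⟩ +ₚ-identityʳ _) ⟩
    (previous (dyckSum n) k +ₚ w k *ₚ dyckSum n (suc k)) +ₚ dyckSum n k
      ≈⟨ rearrange (previous (dyckSum n) k) (w k *ₚ dyckSum n (suc k)) (dyckSum n k) ⟩
    step (dyckSum n) k ∎
    where
    term lower upper : ℕ → Poly
    term  a = binomial n a *ₚ dyck a k
    lower a = binomial n a *ₚ dyck (suc a) k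
    upper a = binomial n (suc a) *ₚ dyck (suc a) k
    open ≋-Reasoning
    split : ∀ a → binomial (suc n) (suc a) *ₚ dyck (suc a) k ≋ lower a +ₚ upper a
    split a = *ₚ-congˡ (dyck (suc a) k) (≡⇒≋ (cong (const ∘ +_) (sym (nCk+nC[k+1]≡[n+1]C[k+1] n a))))
              ⟨≋⟩ *ₚ-distribʳ (dyck (suc a) k) (binomial n a) (binomial n (suc a))
    top-vanishes : binomial n (suc n) *ₚ dyck (suc n) k ≋ []
    top-vanishes = *ₚ-congˡ (dyck (suc n) k)
                     (≡⇒≋ (cong (const ∘ +_) (k>n⇒nCk≡0 (ℕP.n<1+n n))) ⟨≋⟩ ∷-zero refl ≋-refl)
    rearrange : ∀ p d s → (p +ₚ d) +ₚ s ≋ (p +ₚ s) +ₚ d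
    rearrange = solve-∀ ℤ[q]-solver

  motzkin-binomial : ∀ n k → motzkin n k ≋ dyckSum n k
  motzkin-binomial zero    zero    = ≋-sym (*ₚ-identityˡ 1ₚ)
  motzkin-binomial zero    (suc k) = ≋-sym (*ₚ-zeroʳ 1ₚ)
  motzkin-binomial (suc n) k       = step-cong (motzkin-binomial n) k ⟨≋⟩ ≋-sym (dyckSum-step n k)

-- q-analogues

qpow-+ : ∀ a b → qpow (a ℕ.+ b) ≋ qpow a *ₚ qpow b
qpow-+ zero    b = ≋-sym (*ₚ-identityˡ (qpow b))
qpow-+ (suc a) b =
  ∷-cong refl (qpow-+ a b) ⟨≋⟩ ≋-sym (+ₚ-congˡ (+ 0 ∷ qpow a *ₚ qpow b) (scale-zero (qpow b)))

qint-+ : ∀ a b → qint (a ℕ.+ b) ≋ qint a +ₚ qpow a *ₚ qint b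
qint-+ zero    b = ≋-sym (*ₚ-identityˡ (qint b))
qint-+ (suc a) b =
  ∷-cong refl (qint-+ a b)
  ⟨≋⟩ ≋-sym (+ₚ-congʳ (qint (suc a)) (+ₚ-congˡ (+ 0 ∷ qpow a *ₚ qint b) (scale-zero (qint b))))

-- qbinom k r is the Gaussian binomial coefficient [k + r choose k]_q
qbinom : ℕ → ℕ → Poly
qbinom zero    r       = 1ₚ
qbinom (suc k) zero    = 1ₚ
qbinom (suc k) (suc r) = qbinom k (suc r) +ₚ qpow (suc k) *ₚ qbinom (suc k) r

qbinom-zeroʳ : ∀ k → qbinom k 0 ≋ 1ₚ
qbinom-zeroʳ zero    = ≋-refl
qbinom-zeroʳ (suc k) = ≋-refl

qbinom-oneˡ : ∀ r → qbinom 1 r ≋ qint (suc r)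
qbinom-oneˡ zero    = ≋-refl
qbinom-oneˡ (suc r) = +ₚ-congʳ 1ₚ (*ₚ-congʳ (qpow 1) (qbinom-oneˡ r)) ⟨≋⟩ ≋-sym (qint-+ 1 (suc r))

qint-suc : ∀ n → qint (suc n) ≋ qint n +ₚ qpow n
qint-suc n =
  ≡⇒≋ (cong qint (ℕP.+-comm 1 n)) ⟨≋⟩ qint-+ n 1 ⟨≋⟩ +ₚ-congʳ (qint n) (*ₚ-identityʳ (qpow n))

qbinom-oneʳ : ∀ k → qbinom k 1 ≋ qint (suc k)
qbinom-oneʳ zero    = ≋-refl
qbinom-oneʳ (suc k) = +ₚ-cong (qbinom-oneʳ k) (*ₚ-identityʳ (qpow (suc k))) ⟨≋⟩ ≋-sym (qint-suc (suc k))

qbinom-absorb : ∀ k r → qint (suc r) *ₚ qbinom k (suc r) ≋ qint (suc k) *ₚ qbinom (suc k) r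
qbinom-absorb zero    r       = *ₚ-identityʳ (qint (suc r)) ⟨≋⟩ ≋-sym (*ₚ-identityˡ _ ⟨≋⟩ qbinom-oneˡ r)
qbinom-absorb (suc k) zero    = *ₚ-identityˡ _ ⟨≋⟩ qbinom-oneʳ (suc k) ⟨≋⟩ ≋-sym (*ₚ-identityʳ _)
qbinom-absorb (suc k) (suc r) = begin
  I₂ *ₚ (qbinom k (2 ℕ.+ r) +ₚ Q₁ *ₚ X)        ≈⟨ *ₚ-distribˡ I₂ (qbinom k (2 ℕ.+ r)) (Q₁ *ₚ X) ⟩
  I₂ *ₚ qbinom k (2 ℕ.+ r) +ₚ I₂ *ₚ (Q₁ *ₚ X)  ≈⟨ +ₚ-congˡ (I₂ *ₚ (Q₁ *ₚ X)) (qbinom-absorb k (suc r)) ⟩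
  J₁ *ₚ X +ₚ I₂ *ₚ (Q₁ *ₚ X)                   ≈⟨ factor J₁ Q₁ I₂ X ⟩
  (J₁ +ₚ Q₁ *ₚ I₂) *ₚ X                        ≈⟨ *ₚ-congˡ X regroup ⟩
  (J₂ +ₚ Q₂ *ₚ I₁) *ₚ X                        ≈⟨ expand J₂ Q₂ I₁ X ⟩
  J₂ *ₚ X +ₚ Q₂ *ₚ (I₁ *ₚ X)                   ≈⟨ +ₚ-congʳ (J₂ *ₚ X) (*ₚ-congʳ Q₂ (qbinom-absorb (suc k) r)) ⟩
  J₂ *ₚ X +ₚ Q₂ *ₚ (J₂ *ₚ Y)                   ≈⟨ factorˡ J₂ Q₂ X Y ⟩
  J₂ *ₚ (X +ₚ Q₂ *ₚ Y)                         ∎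
  where
  open ≋-Reasoning
  I₁ I₂ J₁ J₂ Q₁ Q₂ X Y : Poly
  I₁ = qint (suc r)
  I₂ = qint (2 ℕ.+ r)
  J₁ = qint (suc k)
  J₂ = qint (2 ℕ.+ k)
  Q₁ = qpow (suc k)
  Q₂ = qpow (2 ℕ.+ k)
  X = qbinom (suc k) (suc r)
  Y = qbinom (2 ℕ.+ k) r
  -- both sides are [k + r + 3]
  regroup : J₁ +ₚ Q₁ *ₚ I₂ ≋ J₂ +ₚ Q₂ *ₚ I₁
  regroup = ≋-sym (qint-+ (suc k) (2 ℕ.+ r))
            ⟨≋⟩ ≡⇒≋ (cong qint (ℕP.+-suc (suc k) (suc r))) ⟨≋⟩ qint-+ (2 ℕ.+ k) (suc r)
  factor : ∀ j q i x → j *ₚ x +ₚ i *ₚ (q *ₚ x) ≋ (j +ₚ q *ₚ i) *ₚ x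
  factor = solve-∀ ℤ[q]-solver
  expand : ∀ j q i x → (j +ₚ q *ₚ i) *ₚ x ≋ j *ₚ x +ₚ q *ₚ (i *ₚ x)
  expand = solve-∀ ℤ[q]-solver
  factorˡ : ∀ j q x y → j *ₚ x +ₚ q *ₚ (j *ₚ y) ≋ j *ₚ (x +ₚ q *ₚ y)
  factorˡ = solve-∀ ℤ[q]-solver

perfectMatchings : ℕ → Poly
perfectMatchings zero          = 1ₚ
perfectMatchings (suc zero)    = []
perfectMatchings (suc (suc r)) = qint (suc r) *ₚ perfectMatchings r

perfectMatchings-odd : ∀ t → perfectMatchings (suc (2 ℕ.* t)) ≋ []
perfectMatchings-odd zero    = ≋-refl
perfectMatchings-odd (suc t) =
  ≡⇒≋ (cong (perfectMatchings ∘ suc) (ℕP.*-suc 2 t))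
  ⟨≋⟩ *ₚ-absorbʳ (qint (2 ℕ.+ 2 ℕ.* t)) (perfectMatchings-odd t)

perfectMatchings-even : ∀ t → perfectMatchings (2 ℕ.* t) ≋ oddProd t
perfectMatchings-even zero    = ≋-refl
perfectMatchings-even (suc t) =
  ≡⇒≋ (cong perfectMatchings (ℕP.*-suc 2 t))
  ⟨≋⟩ *ₚ-congʳ (qint (suc (2 ℕ.* t))) (perfectMatchings-even t) ⟨≋⟩ *ₚ-comm _ _

qWeight : ℕ → Poly
qWeight k = qpow k *ₚ qint (suc k)

open WeightedPaths qWeight

weight≋diagEntry : ∀ k → weight k ≋ diagEntry k
weight≋diagEntry zero    = ≋-sym (*ₚ-identityˡ 1ₚ)
weight≋diagEntry (suc k) = begin
  qWeight k *ₚ weight k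
    ≈⟨ *ₚ-congʳ (qWeight k) (weight≋diagEntry k) ⟩
  (qpow k *ₚ qint (suc k)) *ₚ (qpow (k C 2) *ₚ qfact k)
    ≈⟨ regroup (qpow k) (qint (suc k)) (qpow (k C 2)) (qfact k) ⟩
  (qpow k *ₚ qpow (k C 2)) *ₚ qfact (suc k)
    ≈⟨ *ₚ-congˡ (qfact (suc k)) (≋-sym (qpow-+ k (k C 2))) ⟩
  qpow (k ℕ.+ k C 2) *ₚ qfact (suc k)
    ≈⟨ ≡⇒≋ (cong (λ e → qpow e *ₚ qfact (suc k)) (sym (sucC2 k))) ⟩
  diagEntry (suc k) ∎
  where
  open ≋-Reasoning
  regroup : ∀ a i b f → (a *ₚ i) *ₚ (b *ₚ f) ≋ (a *ₚ b) *ₚ (f *ₚ i)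
  regroup = solve-∀ ℤ[q]-solver
  sucC2 : ∀ k → suc k C 2 ≡ k ℕ.+ k C 2
  sucC2 k = trans (sym (nCk+nC[k+1]≡[n+1]C[k+1] k 1)) (cong (ℕ._+ k C 2) (nC1≡n k))

dyck-closed : ∀ r k → dyck (r ℕ.+ k) k ≋ qbinom k r *ₚ perfectMatchings r
dyck-closed zero zero = ≋-refl
dyck-closed zero (suc k) =
  +ₚ-cong (dyck-closed zero k ⟨≋⟩ *ₚ-congˡ 1ₚ (qbinom-zeroʳ k))
          (*ₚ-absorbʳ (qWeight (suc k)) (dyck-upper k (2 ℕ.+ k) (ℕP.m<n⇒m<1+n (ℕP.n<1+n k))))
  ⟨≋⟩ +ₚ-identityʳ _
dyck-closed (suc zero) zero = *ₚ-zeroʳ (qWeight 0) ⟨≋⟩ ≋-sym (*ₚ-zeroʳ 1ₚ)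
dyck-closed (suc zero) (suc k) =
  +ₚ-cong (dyck-closed 1 k ⟨≋⟩ *ₚ-zeroʳ (qbinom k 1))
          (*ₚ-absorbʳ (qWeight (suc k)) (dyck-upper (suc k) (2 ℕ.+ k) (ℕP.n<1+n (suc k))))
  ⟨≋⟩ ≋-sym (*ₚ-zeroʳ (qbinom (suc k) 1))
dyck-closed (suc (suc r)) zero = begin
  qWeight 0 *ₚ dyck (suc r ℕ.+ 0) 1
    ≈⟨ *ₚ-congʳ (qWeight 0)
                (dyck-cong 1 (trans (ℕP.+-identityʳ (suc r)) (ℕP.+-comm 1 r)) ⟨≋⟩ dyck-closed r 1) ⟩
  qWeight 0 *ₚ (qbinom 1 r *ₚ perfectMatchings r)
    ≈⟨ *ₚ-cong (*ₚ-identityˡ 1ₚ) (*ₚ-congˡ (perfectMatchings r) (qbinom-oneˡ r)) ⟩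
  1ₚ *ₚ perfectMatchings (2 ℕ.+ r) ∎
  where open ≋-Reasoning
dyck-closed (suc (suc r)) (suc k) = begin
  dyck (suc r ℕ.+ suc k) k +ₚ qWeight (suc k) *ₚ dyck (suc r ℕ.+ suc k) (2 ℕ.+ k)
    ≈⟨ +ₚ-cong (dyck-cong k (ℕP.+-suc (suc r) k) ⟨≋⟩ dyck-closed (suc (suc r)) k)
               (*ₚ-congʳ (qWeight (suc k)) (dyck-cong (2 ℕ.+ k) shift ⟨≋⟩ dyck-closed r (suc (suc k)))) ⟩
  A *ₚ (I *ₚ M) +ₚ (Q *ₚ J) *ₚ (Y *ₚ M)
    ≈⟨ regroup A M I Q J Y ⟩
  A *ₚ (I *ₚ M) +ₚ (Q *ₚ M) *ₚ (J *ₚ Y)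
    ≈⟨ +ₚ-congʳ (A *ₚ (I *ₚ M)) (*ₚ-congʳ (Q *ₚ M) (≋-sym (qbinom-absorb (suc k) r))) ⟩
  A *ₚ (I *ₚ M) +ₚ (Q *ₚ M) *ₚ (I *ₚ X)
    ≈⟨ factor A M I Q X ⟩
  (A +ₚ Q *ₚ X) *ₚ (I *ₚ M) ∎
  where
  open ≋-Reasoning
  A M I Q J X Y : Poly
  A = qbinom k (2 ℕ.+ r)
  M = perfectMatchings r
  I = qint (suc r)
  Q = qpow (suc k)
  J = qint (2 ℕ.+ k)
  X = qbinom (suc k) (suc r)
  Y = qbinom (2 ℕ.+ k) r
  shift : suc r ℕ.+ suc k ≡ r ℕ.+ (2 ℕ.+ k)
  shift = sym (ℕP.+-suc r (suc k))
  regroup : ∀ a m i q j y → a *ₚ (i *ₚ m) +ₚ (q *ₚ j) *ₚ (y *ₚ m) ≋ a *ₚ (i *ₚ m) +ₚ (q *ₚ m) *ₚ (j *ₚ y)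
  regroup = solve-∀ ℤ[q]-solver
  factor : ∀ a m i q x → a *ₚ (i *ₚ m) +ₚ (q *ₚ m) *ₚ (i *ₚ x) ≋ (a +ₚ q *ₚ x) *ₚ (i *ₚ m)
  factor = solve-∀ ℤ[q]-solver

dyck-zero : ∀ a → dyck a 0 ≋ perfectMatchings a
dyck-zero a = dyck-cong 0 (sym (ℕP.+-identityʳ a)) ⟨≋⟩ dyck-closed a 0 ⟨≋⟩ *ₚ-identityˡ (perfectMatchings a)

parity : ∀ m → m ≡ 2 ℕ.* ⌊ m /2⌋ ⊎ m ≡ suc (2 ℕ.* ⌊ m /2⌋)
parity zero          = inj₁ refl
parity (suc zero)    = inj₂ refl
parity (suc (suc m)) with parity m
... | inj₁ e = inj₁ (trans (cong (2 ℕ.+_) e) (sym (ℕP.*-suc 2 ⌊ m /2⌋)))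
... | inj₂ e = inj₂ (trans (cong (2 ℕ.+_) e) (cong suc (sym (ℕP.*-suc 2 ⌊ m /2⌋))))

sumBelow-length : ∀ {K K'} f → K ≡ K' → sumBelow K f ≋ sumBelow K' f
sumBelow-length f refl = ≋-refl

module _ (g : ℕ → Poly) (g-odd : ∀ t → g (suc (2 ℕ.* t)) ≋ []) where

  sumBelow-evens-even : ∀ t → sumBelow (suc (2 ℕ.* t)) g ≋ sumUpTo t (g ∘ (2 ℕ.*_))
  sumBelow-evens-odd  : ∀ t → sumBelow (2 ℕ.+ 2 ℕ.* t) g ≋ sumUpTo t (g ∘ (2 ℕ.*_))

  sumBelow-evens-even zero    = ≋-refl
  sumBelow-evens-even (suc t) =
    sumBelow-length g (cong suc (ℕP.*-suc 2 t))
    ⟨≋⟩ +ₚ-cong (sumBelow-evens-odd t) (≡⇒≋ (cong g (sym (ℕP.*-suc 2 t))))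

  sumBelow-evens-odd t = +ₚ-cong (sumBelow-evens-even t) (g-odd t) ⟨≋⟩ +ₚ-identityʳ _

  sumBelow-evens : ∀ m → sumBelow (suc m) g ≋ sumUpTo ⌊ m /2⌋ (g ∘ (2 ℕ.*_))
  sumBelow-evens m with parity m
  ... | inj₁ e = sumBelow-length g (cong suc e) ⟨≋⟩ sumBelow-evens-even ⌊ m /2⌋
  ... | inj₂ e = sumBelow-length g (cong suc e) ⟨≋⟩ sumBelow-evens-odd ⌊ m /2⌋

sumUpTo-cong : ∀ t {f g} → (∀ k → f k ≋ g k) → sumUpTo t f ≋ sumUpTo t g
sumUpTo-cong zero    e = e 0
sumUpTo-cong (suc t) e = +ₚ-cong (sumUpTo-cong t e) (e (suc t))

motzkin-Match : ∀ m → motzkin m 0 ≋ Match m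
motzkin-Match m =
  motzkin-binomial m 0
  ⟨≋⟩ sumBelow-cong (suc m) (λ a _ → *ₚ-congʳ (binomial m a) (dyck-zero a))
  ⟨≋⟩ sumBelow-evens (λ a → binomial m a *ₚ perfectMatchings a)
                     (λ t → *ₚ-absorbʳ (binomial m (suc (2 ℕ.* t))) (perfectMatchings-odd t)) m
  ⟨≋⟩ sumUpTo-cong ⌊ m /2⌋ (λ k → *ₚ-congʳ (binomial m (2 ℕ.* k)) (perfectMatchings-even k))

motzkinMatrix : ∀ n → Matrix n n
motzkinMatrix n i j = motzkin (toℕ i) (toℕ j)

weights : ∀ n → Fin n → Poly
weights n k = weight (toℕ k)

MatchMatrix-LDLᵀ : ∀ n →
                   MatchMatrix n ≋ₘ (motzkinMatrix (suc n) · diag (weights (suc n))) · motzkinMatrix (suc n) ᵀ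
MatchMatrix-LDLᵀ n i j = begin
  Match (a ℕ.+ b)
    ≈⟨ motzkin-Match (a ℕ.+ b) ⟨
  motzkin (a ℕ.+ b) 0
    ≈⟨ motzkin-gram n a b (FinP.toℕ≤pred[n] i) (FinP.toℕ≤pred[n] j) ⟨
  pairing (suc n) (motzkin a) (motzkin b)
    ≈⟨ sumFin-toℕ (suc n) (λ k → motzkin a k *ₚ weight k *ₚ motzkin b k) ⟨
  sumFin {suc n} (λ k → motzkin a (toℕ k) *ₚ weight (toℕ k) *ₚ motzkin b (toℕ k))
    ≈⟨ sumFin-cong {suc n} (λ k → *ₚ-congˡ (motzkin b (toℕ k)) (·-diag L (weights (suc n)) i k)) ⟨
  ((L · diag (weights (suc n))) · L ᵀ) i j ∎
  where
  open ≋-Reasoning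
  L : Matrix (suc n) (suc n)
  L = motzkinMatrix (suc n)
  a b : ℕ
  a = toℕ i
  b = toℕ j

diag-weights≋TargetDiag : ∀ n → diag (weights (suc n)) ≋ₘ TargetDiag n
diag-weights≋TargetDiag n i j with i ≟ j
... | yes _ = weight≋diagEntry (toℕ i)
... | no  _ = ≋-refl

TargetDiag-onDiagonal : ∀ n {i j : Fin (suc n)} → toℕ i ≡ toℕ j → TargetDiag n i j ≋ weight (toℕ i)
TargetDiag-onDiagonal n {i} i≡j with FinP.toℕ-injective i≡j
... | refl = ≋-sym (diag-weights≋TargetDiag n i i) ⟨≋⟩ diag-≡ (weights (suc n)) i

TargetDiag-isDiagonal : ∀ n → IsDiagonal (TargetDiag n)
TargetDiag-isDiagonal n i j i≢j = ≋⇒≈ (≋-sym (diag-weights≋TargetDiag n i j) ⟨≋⟩ diag-≢ _ (i≢j ∘ cong toℕ))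

TargetDiag-divChain : ∀ n → DiagDivChain (TargetDiag n)
TargetDiag-divChain n i i' j j' i≡j i'≡j' i'≤i =
  let c , e = weight-∣ (toℕ i ℕ.∸ toℕ i') (toℕ i') in
  c , ≋⇒≈ (TargetDiag-onDiagonal n i≡j ⟨≋⟩ ≡⇒≋ (cong weight (sym (ℕP.m∸n+n≡m i'≤i))) ⟨≋⟩ e
           ⟨≋⟩ *ₚ-congʳ c (≋-sym (TargetDiag-onDiagonal n i'≡j')))

corollary4p5 : (n : ℕ) → IsSSNF (MatchMatrix n) (TargetDiag n)
corollary4p5 n =
  (P , P ᵀ , ≋⇒≈ (det-lowerUnitriangular P P-lower) , ≋⇒≈ (det-upperUnitriangular (P ᵀ) P-lower) ,
   λ i j → ≋⇒≈ (reduces i j)) ,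
  TargetDiag-isDiagonal n , TargetDiag-divChain n
  where
  L P : Matrix (suc n) (suc n)
  L = motzkinMatrix (suc n)
  P = lowerInverse L
  P-lower : IsLowerUnitriangular P
  P-lower = lowerInverse-lowerUnitriangular L
  reduces : (P · MatchMatrix n) · P ᵀ ≋ₘ TargetDiag n
  reduces = unitriangular-congruence (MatchMatrix n) L (weights (suc n))
                                     (motzkin-lowerUnitriangular (suc n) 0) (MatchMatrix-LDLᵀ n)
            ⟨≋ₘ⟩ diag-weights≋TargetDiag n
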